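{- For every square-free integer $D\geq 2$ there exist infinitely many positive integers $d$ such that the square-free part of $(d-1)^2-4=(d+1)(d-3)$ is equal to $D$. -}

module Defs where

open import Data.Nat as ℕ using (ℕ)
open import Data.Nat.Divisibility using (_∣_)
open import Data.Integer using (ℤ; +_; _*_)
open import Data.Product using (∃; _×_)
open import Relation.Binary.PropositionalEquality using (_≡_)

SquareFree : ℕ → Set
SquareFree n = ∀ (k : ℕ) → (k ℕ.* k) ∣ n → k ≡ 1

-- "The square-free part of the integer z is the natural number D":
-- D is square-free and z = D * m^2 for some integer m.  (For z ≠ 0 the
-- square-free part is unique, so this relation determines it; since we only
-- use it with D ≥ 2 it forces z > 0.)
SquareFreePartIs : ℤ → ℕ → Set
SquareFreePartIs z D = SquareFree D × ∃ λ (m : ℤ) → z ≡ (+ D) * (m * m)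

-- With d = 2X + 1 one has (d + 1)(d − 3) = 4 (X² − 1), so every solution of Pell's equation
-- X² − D Y² = 1 gives a d for which (d + 1)(d − 3) = D (2Y)², and it suffices that Pell's equation
-- has solutions with X arbitrarily large when D is not a square.  Such a solution comes from the
-- continued fraction of √D.  With s = ⌊√D⌋, the reduced quadratic irrationals (P + √D) / Q
-- (P ≤ s < P + Q, Q ≤ P + s) form a finite set on which the continued-fraction step
-- ξ ↦ 1 / (ξ − ⌊ξ⌋) is injective, so the expansion of s + √D returns to s + √D; tracking the
-- convergents p / q of √D along the way, at the return p² − D q² = ±1.  Squaring p + q √D gives a
-- solution of X² − D Y² = 1 with X ≥ 2, and squaring again and again makes X as large as needed.

module Submission where

open import Defs

module Pell where
  open import Data.Empty using (⊥-elim)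
  open import Data.Fin using (toℕ; fromℕ<)
  open import Data.Fin.Properties using (pigeonhole; toℕ-fromℕ<)
  open import Data.List using (_∷_; [])
  open import Data.Nat
  open import Data.Nat.Divisibility using (∣-reflexive)
  open import Data.Nat.DivMod using (_/_; _%_; m/n*n≤m; m≡m%n+[m/n]*n; m%n<n; [m+kn]%n≡m%n; m<n⇒m%n≡m)
  open import Data.Nat.GeneralisedArithmetic using (fold; iterate; fold-+; iterate-is-fold)
  open import Data.Nat.Properties
  open import Data.Nat.Tactic.RingSolver using (solve)
  open import Data.Product using (∃; ∃₂; _×_; _,_; proj₁; proj₂)
  open import Data.Sum using (_⊎_; inj₁; inj₂)
  open import Relation.Binary.Definitions using (tri<; tri≈; tri>)
  open import Relation.Binary.PropositionalEquality
  open import Relation.Nullary using (yes; no)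

  Consecutive : ℕ → ℕ → Set
  Consecutive m n = suc m ≡ n ⊎ suc n ≡ m

  consecutive-sym : ∀ {m n} → Consecutive m n → Consecutive n m
  consecutive-sym (inj₁ e) = inj₂ e
  consecutive-sym (inj₂ e) = inj₁ e

  consecutive-+ˡ : ∀ k {m n} → Consecutive m n → Consecutive (k + m) (k + n)
  consecutive-+ˡ k (inj₁ e) = inj₁ (trans (sym (+-suc k _)) (cong (k +_) e))
  consecutive-+ˡ k (inj₂ e) = inj₂ (trans (sym (+-suc k _)) (cong (k +_) e))

  consecutive⇒[m+n]²≡1+4mn : ∀ {m n} → Consecutive m n → (m + n) * (m + n) ≡ suc (4 * m * n)
  consecutive⇒[m+n]²≡1+4mn {m} (inj₁ refl) = solve (m ∷ [])
  consecutive⇒[m+n]²≡1+4mn {n = n} (inj₂ refl) = solve (n ∷ [])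

  norm-≤-square : ∀ {P Q R s} → P + Q ≤ s → R ≤ P + s → Q * R + P * P ≤ s * s
  norm-≤-square {P} {Q} {R} P+Q≤s R≤P+s
    with u , refl ← m≤n⇒∃[o]m+o≡n (≤-trans (m≤m+n P Q) P+Q≤s) = begin
      Q * R + P * P             ≤⟨ +-monoˡ-≤ (P * P) (*-mono-≤ (+-cancelˡ-≤ P Q u P+Q≤s) R≤P+s) ⟩
      u * (P + (P + u)) + P * P ≡⟨ solve (P ∷ u ∷ []) ⟩
      (P + u) * (P + u)         ∎
    where open ≤-Reasoning

  square-≤-norm : ∀ {P Q R t} → P ≤ t → t ≤ P + R → P + t ≤ Q → t * t ≤ Q * R + P * P
  square-≤-norm {P} {Q} {R} P≤t t≤P+R P+t≤Q
    with u , refl ← m≤n⇒∃[o]m+o≡n P≤t = begin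
      (P + u) * (P + u)         ≡⟨ solve (P ∷ u ∷ []) ⟩
      (P + (P + u)) * u + P * P ≤⟨ +-monoˡ-≤ (P * P) (*-mono-≤ P+t≤Q (+-cancelˡ-≤ P u R t≤P+R)) ⟩
      Q * R + P * P             ∎
    where open ≤-Reasoning

  norm-shift : ∀ {P P′ Q R a} → P′ + P ≡ a * Q →
               Q * (R + 2 * a * P) + P′ * P′ ≡ Q * (a * a * Q) + (Q * R + P * P)
  norm-shift {P} {P′} {Q} {R} {a} P′+P≡aQ = begin
    Q * (R + 2 * a * P) + P′ * P′       ≡⟨ solve (P ∷ P′ ∷ Q ∷ R ∷ a ∷ []) ⟩
    Q * R + 2 * P * (a * Q) + P′ * P′   ≡⟨ cong (λ x → Q * R + 2 * P * x + P′ * P′) P′+P≡aQ ⟨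
    Q * R + 2 * P * (P′ + P) + P′ * P′  ≡⟨ solve (P ∷ P′ ∷ Q ∷ R ∷ []) ⟩
    (P′ + P) * (P′ + P) + (Q * R + P * P) ≡⟨ cong (λ x → x * x + (Q * R + P * P)) P′+P≡aQ ⟩
    a * Q * (a * Q) + (Q * R + P * P)   ≡⟨ solve (P ∷ Q ∷ R ∷ a ∷ []) ⟩
    Q * (a * a * Q) + (Q * R + P * P)   ∎
    where open ≡-Reasoning

  norm-step : ∀ {P P′ Q Q′ R a} → P′ + P ≡ a * Q → Q′ + a * a * Q ≡ R + 2 * a * P →
              Q′ * Q + P′ * P′ ≡ Q * R + P * P
  norm-step {P} {P′} {Q} {Q′} {R} {a} P′+P≡aQ Q′+a²Q≡R+2aP = +-cancelʳ-≡ (Q * (a * a * Q)) _ _ (begin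
    Q′ * Q + P′ * P′ + Q * (a * a * Q)   ≡⟨ solve (P′ ∷ Q ∷ Q′ ∷ a ∷ []) ⟩
    Q * (Q′ + a * a * Q) + P′ * P′       ≡⟨ cong (λ x → Q * x + P′ * P′) Q′+a²Q≡R+2aP ⟩
    Q * (R + 2 * a * P) + P′ * P′        ≡⟨ norm-shift {P} {P′} {Q} {R} {a} P′+P≡aQ ⟩
    Q * (a * a * Q) + (Q * R + P * P)    ≡⟨ +-comm (Q * (a * a * Q)) _ ⟩
    Q * R + P * P + Q * (a * a * Q)      ∎)
    where open ≡-Reasoning

  multiple-gap : ∀ {X P P′ Q a a′} → X + P ≡ a * Q → X + P′ ≡ a′ * Q → a < a′ → P + Q ≤ P′
  multiple-gap {X} {P} {P′} {Q} {a} {a′} X+P≡aQ X+P′≡a′Q a<a′ = +-cancelˡ-≤ X _ _ (begin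
    X + (P + Q) ≡⟨ +-assoc X P Q ⟨
    X + P + Q   ≡⟨ cong (_+ Q) X+P≡aQ ⟩
    a * Q + Q   ≡⟨ +-comm (a * Q) Q ⟩
    suc a * Q   ≤⟨ *-monoˡ-≤ Q a<a′ ⟩
    a′ * Q      ≡⟨ X+P′≡a′Q ⟨
    X + P′      ∎)
    where open ≤-Reasoning

  congruent-in-window⇒≡ : ∀ {X P₁ P₂ Q a₁ a₂ s} → X + P₁ ≡ a₁ * Q → X + P₂ ≡ a₂ * Q →
                          P₁ ≤ s → P₂ ≤ s → s < P₁ + Q → s < P₂ + Q → P₁ ≡ P₂
  congruent-in-window⇒≡ {X} {P₁} {P₂} {a₁ = a₁} {a₂} e₁ e₂ P₁≤s P₂≤s s<P₁+Q s<P₂+Q with <-cmp a₁ a₂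
  ... | tri< a₁<a₂ _ _ = ⊥-elim (<⇒≱ (<-≤-trans s<P₁+Q (multiple-gap e₁ e₂ a₁<a₂)) P₂≤s)
  ... | tri≈ _ refl _ = +-cancelˡ-≡ X P₁ P₂ (trans e₁ (sym e₂))
  ... | tri> _ _ a₂<a₁ = ⊥-elim (<⇒≱ (<-≤-trans s<P₂+Q (multiple-gap e₂ e₁ a₂<a₁)) P₁≤s)

  m<m/n*n+n : ∀ m n .{{_ : NonZero n}} → m < m / n * n + n
  m<m/n*n+n m n = begin-strict
    m                 ≡⟨ m≡m%n+[m/n]*n m n ⟩
    m % n + m / n * n <⟨ +-monoˡ-< (m / n * n) (m%n<n m n) ⟩
    n + m / n * n     ≡⟨ +-comm n _ ⟩
    m / n * n + n     ∎
    where open ≤-Reasoning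

  +-*-injective : ∀ {n P₁ P₂ Q₁ Q₂} → P₁ < n → P₂ < n → P₁ + Q₁ * n ≡ P₂ + Q₂ * n → P₁ ≡ P₂ × Q₁ ≡ Q₂
  +-*-injective {n@(suc _)} {P₁} {P₂} {Q₁} {Q₂} P₁<n P₂<n e = P₁≡P₂ , Q₁≡Q₂
    where
    open ≡-Reasoning
    P₁≡P₂ : P₁ ≡ P₂
    P₁≡P₂ = begin
      P₁                 ≡⟨ m<n⇒m%n≡m P₁<n ⟨
      P₁ % n             ≡⟨ [m+kn]%n≡m%n P₁ Q₁ n ⟨
      (P₁ + Q₁ * n) % n  ≡⟨ cong (_% n) e ⟩
      (P₂ + Q₂ * n) % n  ≡⟨ [m+kn]%n≡m%n P₂ Q₂ n ⟩
      P₂ % n             ≡⟨ m<n⇒m%n≡m P₂<n ⟩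
      P₂                 ∎
    Q₁≡Q₂ : Q₁ ≡ Q₂
    Q₁≡Q₂ = *-cancelʳ-≡ Q₁ Q₂ n (+-cancelˡ-≡ P₁ _ _ (trans e (cong (_+ Q₂ * n) (sym P₁≡P₂))))

  ⌊√⌋-exists : ∀ n → ∃ λ s → s * s ≤ n × n < suc s * suc s
  ⌊√⌋-exists zero = 0 , z≤n , s≤s z≤n
  ⌊√⌋-exists (suc n) with s , s²≤n , n<[1+s]² ← ⌊√⌋-exists n with suc n <? suc s * suc s
  ... | yes 1+n<[1+s]² = s , m≤n⇒m≤1+n s²≤n , 1+n<[1+s]²
  ... | no  1+n≮[1+s]² rewrite ≤-antisym n<[1+s]² (≮⇒≥ 1+n≮[1+s]²) =
    suc s , ≤-refl , *-mono-< (n<1+n (suc s)) (n<1+n (suc s))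

  module _ {A : Set} {Good : A → Set} (f : A → A)
           (f-good : ∀ {x} → Good x → Good (f x))
           (f-injective : ∀ {x y} → Good x → Good y → f x ≡ f y → x ≡ y)
           (code : A → ℕ) {bound : ℕ} (code-< : ∀ {x} → Good x → code x < bound)
           (code-injective : ∀ {x y} → Good x → Good y → code x ≡ code y → x ≡ y) where

    fold-good : ∀ {x} n → Good x → Good (fold x f n)
    fold-good zero    gx = gx
    fold-good (suc n) gx = f-good (fold-good n gx)

    fold-injective : ∀ {x y} n → Good x → Good y → fold x f n ≡ fold y f n → x ≡ y
    fold-injective zero    gx gy e = e
    fold-injective (suc n) gx gy e =
      fold-injective n gx gy (f-injective (fold-good n gx) (fold-good n gy) e)

    -- pigeonhole on the first bound + 1 iterates, then cancel the common prefix
    fold-periodic : ∀ {x} → Good x → ∃ λ k → fold x f (suc k) ≡ x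
    fold-periodic {x} gx
      with i , j , i<j , codes≡ ← pigeonhole (n<1+n bound) (λ i → fromℕ< (code-< (fold-good (toℕ i) gx)))
      with k , 1+i+k≡j ← m≤n⇒∃[o]m+o≡n i<j
      = k , sym (fold-injective (toℕ i) gx (fold-good (suc k) gx) (begin
        fold x f (toℕ i)                  ≡⟨ iterates≡ ⟩
        fold x f (toℕ j)                  ≡⟨ cong (fold x f) 1+i+k≡j ⟨
        fold x f (suc (toℕ i + k))        ≡⟨ cong (fold x f) (+-suc (toℕ i) k) ⟨
        fold x f (toℕ i + suc k)          ≡⟨ fold-+ x f (toℕ i) ⟩
        fold (fold x f (suc k)) f (toℕ i) ∎))
      where
      open ≡-Reasoning
      iterates≡ : fold x f (toℕ i) ≡ fold x f (toℕ j)
      iterates≡ = code-injective (fold-good (toℕ i) gx) (fold-good (toℕ j) gx)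
                    (trans (sym (toℕ-fromℕ< _)) (trans (cong toℕ codes≡) (toℕ-fromℕ< _)))

  -- adding P (a q + q′) + a² Q q to both sides lets P′ and Q′ enter only through P′ + P and Q′ + a² Q
  convergent-step-p : ∀ {P P′ Q Q′ R a p q p′ q′} → P′ + P ≡ a * Q → Q′ + a * a * Q ≡ R + 2 * a * P →
                      p ≡ P * q + Q * q′ → R * q ≡ P * q′ + p′ → a * p + p′ ≡ P′ * (a * q + q′) + Q′ * q
  convergent-step-p {P} {P′} {Q} {Q′} {R} {a} {q = q} {p′} {q′} P′+P≡aQ Q′+a²Q≡R+2aP refl Rq≡Pq′+p′ =
    +-cancelʳ-≡ (P * (a * q + q′) + a * a * Q * q) _ _ (begin
      a * (P * q + Q * q′) + p′ + (P * (a * q + q′) + a * a * Q * q)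
        ≡⟨ solve (P ∷ Q ∷ a ∷ q ∷ p′ ∷ q′ ∷ []) ⟩
      P * q′ + p′ + (2 * a * P * q + a * Q * (a * q + q′))
        ≡⟨ cong (_+ (2 * a * P * q + a * Q * (a * q + q′))) Rq≡Pq′+p′ ⟨
      R * q + (2 * a * P * q + a * Q * (a * q + q′))
        ≡⟨ solve (P ∷ Q ∷ R ∷ a ∷ q ∷ q′ ∷ []) ⟩
      (R + 2 * a * P) * q + a * Q * (a * q + q′)
        ≡⟨ cong₂ (λ x y → x * q + y * (a * q + q′)) Q′+a²Q≡R+2aP P′+P≡aQ ⟨
      (Q′ + a * a * Q) * q + (P′ + P) * (a * q + q′)
        ≡⟨ solve (P ∷ P′ ∷ Q ∷ Q′ ∷ a ∷ q ∷ q′ ∷ []) ⟩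
      P′ * (a * q + q′) + Q′ * q + (P * (a * q + q′) + a * a * Q * q) ∎)
    where open ≡-Reasoning

  convergent-step-q : ∀ {P P′ Q a p q q′} → P′ + P ≡ a * Q → p ≡ P * q + Q * q′ →
                      Q * (a * q + q′) ≡ P′ * q + p
  convergent-step-q {P} {P′} {Q} {a} {q = q} {q′} P′+P≡aQ refl = begin
    Q * (a * q + q′)        ≡⟨ solve (Q ∷ a ∷ q ∷ q′ ∷ []) ⟩
    a * Q * q + Q * q′      ≡⟨ cong (λ x → x * q + Q * q′) P′+P≡aQ ⟨
    (P′ + P) * q + Q * q′   ≡⟨ solve (P ∷ P′ ∷ Q ∷ q ∷ q′ ∷ []) ⟩
    P′ * q + (P * q + Q * q′) ∎
    where open ≡-Reasoning

  unimodular-step : ∀ a {p q p′ q′} → Consecutive (p * q′) (q * p′) →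
                    Consecutive ((a * p + p′) * q) ((a * q + q′) * p)
  unimodular-step a {p} {q} {p′} {q′} c =
    subst₂ Consecutive apq+qp′ apq+pq′ (consecutive-+ˡ (a * p * q) (consecutive-sym c))
    where
    apq+qp′ : a * p * q + q * p′ ≡ (a * p + p′) * q
    apq+qp′ = solve (a ∷ p ∷ q ∷ p′ ∷ [])
    apq+pq′ : a * p * q + p * q′ ≡ (a * q + q′) * p
    apq+pq′ = solve (a ∷ p ∷ q ∷ q′ ∷ [])

  unimodular⇒norm±1 : ∀ {s R p q p′ q′} → p ≡ s * q + 1 * q′ → R * q ≡ s * q′ + p′ →
                      Consecutive (p * q′) (q * p′) → Consecutive (p * p) ((1 * R + s * s) * (q * q))
  unimodular⇒norm±1 {s} {R} {q = q} {p′} {q′} refl Rq≡sq′+p′ c =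
    subst₂ Consecutive p² (begin
      s * q * (s * q + 1 * q′) + q * p′   ≡⟨ solve (s ∷ q ∷ p′ ∷ q′ ∷ []) ⟩
      (s * q′ + p′) * q + s * s * (q * q) ≡⟨ cong (λ x → x * q + s * s * (q * q)) Rq≡sq′+p′ ⟨
      R * q * q + s * s * (q * q)         ≡⟨ solve (s ∷ R ∷ q ∷ []) ⟩
      (1 * R + s * s) * (q * q)           ∎)
      (consecutive-+ˡ (s * q * (s * q + 1 * q′)) c)
    where
    open ≡-Reasoning
    p² : s * q * (s * q + 1 * q′) + (s * q + 1 * q′) * q′ ≡ (s * q + 1 * q′) * (s * q + 1 * q′)
    p² = solve (s ∷ q ∷ q′ ∷ [])

  module ContinuedFraction (D s : ℕ) (s²<D : s * s < D) (D<[1+s]² : D < suc s * suc s) where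

    1≤s : 1 ≤ s
    1≤s = n≢0⇒n>0 λ s≡0 → <⇒≱ (subst (λ t → D < suc t * suc t) s≡0 D<[1+s]²) (≤-trans (s≤s z≤n) s²<D)

    -- form P Q R stands for the quadratic irrational (P + √D) / Q, where Q R = D − P²
    record Form : Set where
      constructor form
      field P Q R : ℕ

    record IsReduced (ξ : Form) : Set where
      open Form ξ
      field
        P≤s   : P ≤ s
        s<P+Q : s < P + Q
        Q≤P+s : Q ≤ P + s
        norm  : Q * R + P * P ≡ D

    reduced⇒1≤Q : ∀ {P Q R} → IsReduced (form P Q R) → 1 ≤ Q
    reduced⇒1≤Q {P} {Q} r = +-cancelˡ-< P 0 Q (begin-strict
      P + 0 ≡⟨ +-identityʳ P ⟩
      P     ≤⟨ P≤s ⟩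
      s     <⟨ s<P+Q ⟩
      P + Q ∎)
      where
      open IsReduced r
      open ≤-Reasoning

    reduced-R-unique : ∀ {P Q R₁ R₂} → IsReduced (form P Q R₁) → IsReduced (form P Q R₂) → R₁ ≡ R₂
    reduced-R-unique {P} {Q} {R₁} {R₂} r₁ r₂ =
      *-cancelˡ-≡ R₁ R₂ Q {{>-nonZero (reduced⇒1≤Q r₁)}}
        (+-cancelʳ-≡ (P * P) _ _ (trans (IsReduced.norm r₁) (sym (IsReduced.norm r₂))))

    -- ⌊(P + √D) / Q⌋ = ⌊(P + s) / Q⌋; the value at Q = 0 is junk (reduced forms have Q ≥ 1)
    ⌊_⌋ : Form → ℕ
    ⌊ form P zero    R ⌋ = 0
    ⌊ form P (suc q) R ⌋ = (P + s) / suc q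

    ⌊⌋-bounds : ∀ {P Q R} → 1 ≤ Q → ⌊ form P Q R ⌋ * Q ≤ P + s × P + s < ⌊ form P Q R ⌋ * Q + Q
    ⌊⌋-bounds {P} {suc q} _ = m/n*n≤m (P + s) (suc q) , m<m/n*n+n (P + s) (suc q)

    -- ξ = ⌊ξ⌋ + 1 / step ξ
    step : Form → Form
    step ξ@(form P Q R) = form (a * Q ∸ P) (R + 2 * a * P ∸ a * a * Q) Q
      where
      a : ℕ
      a = ⌊ ξ ⌋

    module Step {P Q R} (r : IsReduced (form P Q R)) where
      open IsReduced r

      a P′ Q′ : ℕ
      a  = ⌊ form P Q R ⌋
      P′ = a * Q ∸ P
      Q′ = R + 2 * a * P ∸ a * a * Q

      aQ≤P+s : a * Q ≤ P + s
      aQ≤P+s = proj₁ (⌊⌋-bounds (reduced⇒1≤Q r))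

      P+s<aQ+Q : P + s < a * Q + Q
      P+s<aQ+Q = proj₂ (⌊⌋-bounds (reduced⇒1≤Q r))

      1≤a : 1 ≤ a
      1≤a = n≢0⇒n>0 λ a≡0 → <⇒≱ (subst (λ b → P + s < b * Q + Q) a≡0 P+s<aQ+Q) Q≤P+s

      Q≤aQ : Q ≤ a * Q
      Q≤aQ = m≤n*m Q a {{>-nonZero 1≤a}}

      P<aQ : P < a * Q
      P<aQ = ≰⇒> λ aQ≤P → <⇒≱ (s<Q aQ≤P) (≤-trans Q≤aQ (≤-trans aQ≤P P≤s))
        where
        s<Q : a * Q ≤ P → s < Q
        s<Q aQ≤P = +-cancelˡ-< P s Q (<-≤-trans P+s<aQ+Q (+-monoˡ-≤ Q aQ≤P))

      P′+P≡aQ : P′ + P ≡ a * Q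
      P′+P≡aQ = m∸n+n≡m (<⇒≤ P<aQ)

      P′≤s : P′ ≤ s
      P′≤s = m≤n+o⇒m∸n≤o (a * Q) P aQ≤P+s

      s<P′+Q : s < P′ + Q
      s<P′+Q = +-cancelˡ-< P s (P′ + Q) (begin-strict
        P + s        <⟨ P+s<aQ+Q ⟩
        a * Q + Q    ≡⟨ cong (_+ Q) P′+P≡aQ ⟨
        P′ + P + Q   ≡⟨ cong (_+ Q) (+-comm P′ P) ⟩
        P + P′ + Q   ≡⟨ +-assoc P P′ Q ⟩
        P + (P′ + Q) ∎)
        where open ≤-Reasoning

      Q≤P′+s : Q ≤ P′ + s
      Q≤P′+s = begin
        Q      ≤⟨ Q≤aQ ⟩
        a * Q  ≡⟨ P′+P≡aQ ⟨
        P′ + P ≤⟨ +-monoʳ-≤ P′ P≤s ⟩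
        P′ + s ∎
        where open ≤-Reasoning

      a²Q≤R+2aP : a * a * Q ≤ R + 2 * a * P
      a²Q≤R+2aP = *-cancelˡ-≤ Q {{>-nonZero (reduced⇒1≤Q r)}} (<⇒≤ (+-cancelʳ-< (P′ * P′) _ _ (begin-strict
        Q * (a * a * Q) + P′ * P′ <⟨ +-monoʳ-< (Q * (a * a * Q)) P′²<D ⟩
        Q * (a * a * Q) + D       ≡⟨ cong (Q * (a * a * Q) +_) norm ⟨
        Q * (a * a * Q) + (Q * R + P * P) ≡⟨ norm-shift {P} {P′} {Q} {R} {a} P′+P≡aQ ⟨
        Q * (R + 2 * a * P) + P′ * P′ ∎)))
        where
        open ≤-Reasoning
        P′²<D : P′ * P′ < D
        P′²<D = ≤-<-trans (*-mono-≤ P′≤s P′≤s) s²<D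

      norm′ : Q′ * Q + P′ * P′ ≡ D
      norm′ = trans (norm-step {P} {P′} {Q} {Q′} {R} {a} P′+P≡aQ (m∸n+n≡m a²Q≤R+2aP)) norm

      s<P′+Q′ : s < P′ + Q′
      s<P′+Q′ = ≰⇒> λ P′+Q′≤s → <⇒≱ s²<D (subst (_≤ s * s) norm′ (norm-≤-square P′+Q′≤s Q≤P′+s))

      Q′≤P′+s : Q′ ≤ P′ + s
      Q′≤P′+s = ≮⇒≥ λ P′+s<Q′ → <⇒≱ D<[1+s]²
        (subst (suc s * suc s ≤_) norm′ (square-≤-norm (m≤n⇒m≤1+n P′≤s) s<P′+Q
          (subst (_≤ Q′) (sym (+-suc P′ s)) P′+s<Q′)))

      reduced : IsReduced (form P′ Q′ Q)
      reduced = record { P≤s = P′≤s ; s<P+Q = s<P′+Q′ ; Q≤P+s = Q′≤P′+s ; norm = norm′ }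

    step-reduced : ∀ {ξ} → IsReduced ξ → IsReduced (step ξ)
    step-reduced {form P Q R} = Step.reduced

    step-injective : ∀ {ξ η} → IsReduced ξ → IsReduced η → step ξ ≡ step η → ξ ≡ η
    step-injective {form P₁ Q R₁} {form P₂ Q₂ R₂} r₁ r₂ e with refl ← cong Form.R e
      with refl ← congruent-in-window⇒≡ {a₁ = Step.a r₁} {Step.a r₂} (Step.P′+P≡aQ r₁) (trans (cong (_+ P₂) (cong Form.P e)) (Step.P′+P≡aQ r₂))
                    (IsReduced.P≤s r₁) (IsReduced.P≤s r₂) (IsReduced.s<P+Q r₁) (IsReduced.s<P+Q r₂)
      = cong (form P₁ Q) (reduced-R-unique r₁ r₂)

    code : Form → ℕ
    code (form P Q R) = P + Q * suc s

    code-< : ∀ {ξ} → IsReduced ξ → code ξ < suc s + (s + s) * suc s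
    code-< r = +-mono-≤ (s≤s P≤s) (*-monoˡ-≤ (suc s) (≤-trans Q≤P+s (+-monoˡ-≤ s P≤s)))
      where open IsReduced r

    code-injective : ∀ {ξ η} → IsReduced ξ → IsReduced η → code ξ ≡ code η → ξ ≡ η
    code-injective {form P₁ Q₁ R₁} {form P₂ Q₂ R₂} r₁ r₂ e
      with refl , refl ← +-*-injective {Q₁ = Q₁} {Q₂} (s≤s (IsReduced.P≤s r₁)) (s≤s (IsReduced.P≤s r₂)) e
      = cong (form P₁ Q₁) (reduced-R-unique r₁ r₂)

    record Convergents : Set where
      constructor convergents
      field p q p′ q′ : ℕ

    -- √D = (p ξ + p′) / (q ξ + q′), with denominators cleared, and p q′ − q p′ = ±1
    record Represents (ξ : Form) (c : Convergents) : Set where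
      open Form ξ
      open Convergents c
      field
        p≡Pq+Qq′   : p ≡ P * q + Q * q′
        Rq≡Pq′+p′  : R * q ≡ P * q′ + p′
        unimodular : Consecutive (p * q′) (q * p′)
        1≤q        : 1 ≤ q

    advance : ℕ → Convergents → Convergents
    advance a (convergents p q p′ q′) = convergents (a * p + p′) (a * q + q′) p q

    represents-step : ∀ {ξ c} → IsReduced ξ → Represents ξ c → Represents (step ξ) (advance ⌊ ξ ⌋ c)
    represents-step {form P Q R} {convergents p q p′ q′} r rep = record
      { p≡Pq+Qq′   = convergent-step-p {P} {P′} {Q} {Q′} {R} {a} {p} {q} {p′} {q′}
                       P′+P≡aQ (m∸n+n≡m a²Q≤R+2aP) p≡Pq+Qq′ Rq≡Pq′+p′
      ; Rq≡Pq′+p′  = convergent-step-q {P} {P′} {Q} {a} {p} {q} {q′} P′+P≡aQ p≡Pq+Qq′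
      ; unimodular = unimodular-step a unimodular
      ; 1≤q        = ≤-trans (*-mono-≤ 1≤a 1≤q) (m≤m+n (a * q) q′)
      }
      where
      open Step r
      open Represents rep

    represents-iterate : ∀ n {ξ c} → IsReduced ξ → Represents ξ c → ∃ (Represents (iterate step ξ n))
    represents-iterate zero    r rep = _ , rep
    represents-iterate (suc n) r rep = represents-iterate n (step-reduced r) (represents-step r rep)

    ξ₀ : Form
    ξ₀ = form s 1 (D ∸ s * s)

    ξ₀-reduced : IsReduced ξ₀
    ξ₀-reduced = record
      { P≤s = ≤-refl
      ; s<P+Q = ≤-reflexive (+-comm 1 s)
      ; Q≤P+s = ≤-trans 1≤s (m≤m+n s s)
      ; norm = trans (cong (_+ s * s) (+-identityʳ (D ∸ s * s))) (m∸n+n≡m (<⇒≤ s²<D))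
      }

    represents-step-ξ₀ : Represents (step ξ₀) (convergents (Form.P (step ξ₀)) 1 1 0)
    represents-step-ξ₀ = record
      { p≡Pq+Qq′   = sym (trans (cong₂ _+_ (*-identityʳ P) (*-zeroʳ Q)) (+-identityʳ P))
      ; Rq≡Pq′+p′  = cong (_+ 1) (sym (*-zeroʳ P))
      ; unimodular = inj₁ (cong suc (*-zeroʳ P))
      ; 1≤q        = ≤-refl
      }
      where open Form (step ξ₀)

    ξ₀-periodic : ∃ λ k → fold ξ₀ step (suc k) ≡ ξ₀
    ξ₀-periodic = fold-periodic step step-reduced step-injective code code-< code-injective ξ₀-reduced

    ξ₀-returns : ∃ λ k → iterate step (step ξ₀) k ≡ ξ₀
    ξ₀-returns = k , trans (sym (iterate-is-fold ξ₀ step (suc k))) (proj₂ ξ₀-periodic)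
      where
      k : ℕ
      k = proj₁ ξ₀-periodic

    represents-ξ₀ : ∃ (Represents ξ₀)
    represents-ξ₀ = c , subst (λ ξ → Represents ξ c) (proj₂ ξ₀-returns) (proj₂ orbit)
      where
      orbit : ∃ (Represents (iterate step (step ξ₀) (proj₁ ξ₀-returns)))
      orbit = represents-iterate (proj₁ ξ₀-returns) (step-reduced ξ₀-reduced) represents-step-ξ₀
      c : Convergents
      c = proj₁ orbit

    norm±1-solution : ∃₂ λ p q → 1 ≤ q × Consecutive (p * p) (D * (q * q))
    norm±1-solution = p , q , 1≤q , subst (λ n → Consecutive (p * p) (n * (q * q))) (IsReduced.norm ξ₀-reduced)
                                      (unimodular⇒norm±1 {s} {D ∸ s * s} {p} {q} {p′} {q′} p≡Pq+Qq′ Rq≡Pq′+p′ unimodular)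
      where
      open Convergents (proj₁ represents-ξ₀)
      open Represents (proj₂ represents-ξ₀)

  NonSquare : ℕ → Set
  NonSquare D = ∀ s → s * s ≢ D

  nonSquare⇒2≤D : ∀ {D} → NonSquare D → 2 ≤ D
  nonSquare⇒2≤D {0}           ns = ⊥-elim (ns 0 refl)
  nonSquare⇒2≤D {1}           ns = ⊥-elim (ns 1 refl)
  nonSquare⇒2≤D {suc (suc _)} _  = s≤s (s≤s z≤n)

  squareFree⇒nonSquare : ∀ {D} → 2 ≤ D → SquareFree D → NonSquare D
  squareFree⇒nonSquare 2≤D sf s s²≡D with refl ← sf s (∣-reflexive s²≡D) = <-irrefl s²≡D 2≤D

  IsPellSolution : ℕ → ℕ → ℕ → Set
  IsPellSolution D X Y = suc (D * (Y * Y)) ≡ X * X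

  -- (p + q √D)² = (p² + D q²) + 2 p q √D
  norm±1⇒pell : ∀ {D p q} → Consecutive (p * p) (D * (q * q)) →
                IsPellSolution D (p * p + D * (q * q)) (2 * p * q)
  norm±1⇒pell {D} {p} {q} c = trans (cong suc 4p²Dq²) (sym (consecutive⇒[m+n]²≡1+4mn c))
    where
    4p²Dq² : D * (2 * p * q * (2 * p * q)) ≡ 4 * (p * p) * (D * (q * q))
    4p²Dq² = solve (D ∷ p ∷ q ∷ [])

  norm±1⇒pell-nontrivial : ∀ {D} → 2 ≤ D → (∃₂ λ p q → 1 ≤ q × Consecutive (p * p) (D * (q * q))) →
                           ∃₂ λ X Y → 2 ≤ X × IsPellSolution D X Y
  norm±1⇒pell-nontrivial {D} 2≤D (p , q , 1≤q , c) = p * p + D * (q * q) , 2 * p * q , 2≤X , norm±1⇒pell {D} {p} {q} c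
    where
    2≤X : 2 ≤ p * p + D * (q * q)
    2≤X = ≤-trans 2≤D (≤-trans (m≤m*n D (q * q) {{>-nonZero (*-mono-≤ 1≤q 1≤q)}}) (m≤n+m _ (p * p)))

  pell-nontrivial : ∀ {D} → NonSquare D → ∃₂ λ X Y → 2 ≤ X × IsPellSolution D X Y
  pell-nontrivial {D} ns with s , s²≤D , D<[1+s]² ← ⌊√⌋-exists D =
    norm±1⇒pell-nontrivial (nonSquare⇒2≤D ns)
      (ContinuedFraction.norm±1-solution D s (≤∧≢⇒< s²≤D (ns s)) D<[1+s]²)

  pell-doubling : ∀ {D X Y} → IsPellSolution D X Y → IsPellSolution D (X * X + D * (Y * Y)) (2 * X * Y)
  pell-doubling {D} {X} {Y} e = norm±1⇒pell {D} {X} {Y} (inj₂ e)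

  pell-unbounded : ∀ {D} → NonSquare D → ∀ N → ∃₂ λ X Y → 2 + N ≤ X × IsPellSolution D X Y
  pell-unbounded ns zero = pell-nontrivial ns
  pell-unbounded {D} ns (suc N) with X , Y , 2+N≤X , e ← pell-unbounded ns N =
    X * X + D * (Y * Y) , 2 * X * Y , ≤-trans (s≤s 2+N≤X) (≤-trans X<X² (m≤m+n (X * X) _)) , pell-doubling {D} {X} {Y} e
    where
    X<X² : X < X * X
    X<X² = m<m*n X X {{>-nonZero (≤-trans (s≤s z≤n) 2+N≤X)}} (≤-trans (m≤m+n 2 N) 2+N≤X)

  -- d = 2X + 1 with X = 1 + x:  (d + 1)(d − 3) = 4 (X² − 1) = D (2Y)²
  pell⇒discriminant : ∀ {D x Y} → IsPellSolution D (suc x) Y → (3 + 2 * x + 1) * (2 * x) ≡ D * (2 * Y * (2 * Y))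
  pell⇒discriminant {D} {x} {Y} e = begin
    (3 + 2 * x + 1) * (2 * x) ≡⟨ solve (x ∷ []) ⟩
    4 * (x * x + 2 * x)       ≡⟨ cong (4 *_) DY²≡x²+2x ⟨
    4 * (D * (Y * Y))         ≡⟨ solve (D ∷ Y ∷ []) ⟩
    D * (2 * Y * (2 * Y))     ∎
    where
    open ≡-Reasoning
    DY²≡x²+2x : D * (Y * Y) ≡ x * x + 2 * x
    DY²≡x²+2x = suc-injective (trans e (solve (x ∷ [])))

  discriminant-unbounded : ∀ {D} → NonSquare D → ∀ N →
                           ∃₂ λ x Y → N < 3 + 2 * x × (3 + 2 * x + 1) * (2 * x) ≡ D * (2 * Y * (2 * Y))
  discriminant-unbounded {D} ns N with pell-unbounded ns N
  ... | suc x , Y , 2+N≤1+x , e =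
    x , Y , <-≤-trans (s≤s⁻¹ 2+N≤1+x) (≤-trans (m≤n*m x 2) (m≤n+m (2 * x) 3)) , pell⇒discriminant {D} {x} {Y} e

open import Data.Nat using (ℕ; _≤_; _<_)
import Data.Nat as ℕ
open import Data.Integer using (+_; _*_; _+_; _-_)
open import Data.Integer.Properties using (pos-*)
open import Data.Product using (∃; _×_; _,_)
open import Relation.Binary.PropositionalEquality using (_≡_; cong; module ≡-Reasoning)

corollary1 : (D : ℕ) → 2 ≤ D → SquareFree D →
    (N : ℕ) → ∃ λ (d : ℕ) → N < d × SquareFreePartIs ((+ d + + 1) * (+ d - + 3)) D
corollary1 D 2≤D sf N with x , Y , N<d , disc ← Pell.discriminant-unbounded (Pell.squareFree⇒nonSquare 2≤D sf) N =
  d , N<d , sf , + M , (begin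
    (+ d + + 1) * (+ d - + 3)   ≡⟨⟩
    + (d ℕ.+ 1) * + (2 ℕ.* x)   ≡⟨ pos-* (d ℕ.+ 1) (2 ℕ.* x) ⟨
    + ((d ℕ.+ 1) ℕ.* (2 ℕ.* x)) ≡⟨ cong +_ disc ⟩
    + (D ℕ.* (M ℕ.* M))         ≡⟨ pos-* D (M ℕ.* M) ⟩
    + D * + (M ℕ.* M)           ≡⟨ cong (+ D *_) (pos-* M M) ⟩
    + D * (+ M * + M)           ∎)
  where
  open ≡-Reasoning
  -- d = 3 + 2x is chosen so that + d - + 3 computes to + (2x)
  d M : ℕ
  d = 3 ℕ.+ 2 ℕ.* x
  M = 2 ℕ.* Y
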